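{- For every $n \geqslant 4$, $$\sigma(\mathcal{B}_n) - \sigma(\mathcal{B}_{n-1}) = \sum_{i=1}^{n} i .$$
   Context: For a strongly connected digraph $G$, $|x,y|_G$ is the length of a shortest directed path from $x$ to $y$ and $\sigma(G)=\sum_{x\neq y}|x,y|_G$ over ordered pairs. The backward tournament $\mathcal{B}_m$ ($m\geqslant 3$) has vertices $v_1,\dots,v_m$ and arrows $(v_i,v_{i+1})$ for $1\leqslant i\leqslant m-1$ and $(v_i,v_j)$ for $3\leqslant i\leqslant m$, $1\leqslant j\leqslant i-2$. -}

module Defs where

open import Data.Nat using (ℕ; zero; suc; _+_; _≤?_; _≟_)
open import Data.Bool using (Bool; true; false; _∧_; _∨_; if_then_else_)
open import Data.Fin using (Fin; toℕ)
import Data.Fin as F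
open import Data.List using (List; map; allFin; upTo; filter)
open import Data.Bool.ListAction using (any)
open import Data.Nat.ListAction using (sum)
open import Relation.Nullary.Decidable using (⌊_⌋; ¬?)

Digraph : ℕ → Set
Digraph n = Fin n → Fin n → Bool

walkIn : ∀ {n} → Digraph n → ℕ → Fin n → Fin n → Bool
walkIn {n} G zero    x y = ⌊ x F.≟ y ⌋
walkIn {n} G (suc k) x y = any (λ z → G x z ∧ walkIn G k z y) (allFin n)

-- Least k among k₀, k₀+1, ..., k₀+fuel-1 with a walk of length k from x to y
-- (returns k₀+fuel if none).
firstWalk : ∀ {n} → Digraph n → (fuel k₀ : ℕ) → Fin n → Fin n → ℕ
firstWalk G zero       k₀ x y = k₀
firstWalk G (suc fuel) k₀ x y =
  if walkIn G k₀ x y then k₀ else firstWalk G fuel (suc k₀) x y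

-- In a digraph on n vertices a shortest walk, if any, has length < n, so
-- searching k = 0 .. n-1 suffices (for strongly connected G this is exact).
dist : ∀ {n} → Digraph n → Fin n → Fin n → ℕ
dist {n} G x y = firstWalk G n 0 x y

σ : ∀ {n} → Digraph n → ℕ
σ {n} G = sum (map (λ x →
            sum (map (λ y → dist G x y)
                     (filter (λ y → ¬? (x F.≟ y)) (allFin n))))
          (allFin n))

-- Backward tournament B_m: vertex v_i (1-based) is the element of Fin m with
-- toℕ = i - 1.  Arrows: (v_i, v_{i+1}) for 1 ≤ i ≤ m-1, and (v_i, v_j) for
-- 3 ≤ i ≤ m, 1 ≤ j ≤ i-2  (i.e. j + 2 ≤ i, same in 0-based indices).
backward : (m : ℕ) → Digraph m
backward m a b = ⌊ toℕ b ≟ suc (toℕ a) ⌋ ∨ ⌊ suc (suc (toℕ b)) ≤? toℕ a ⌋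

sumTo : ℕ → ℕ
sumTo n = sum (map suc (upTo n))

-- In B_n (n ≥ 3) the distance from v_{a+1} to v_{b+1} depends only on b − a: it is
-- b − a when a ≤ b, 2 when a = b + 1 (via v_{b+3} if b = 0, else via v_b), and 1
-- otherwise, because an arrow raises the index by at most one.  So σ(B_n) is the
-- double sum over a, b < n of a translation-invariant kernel.  Splitting off the first
-- row and column of that double sum leaves σ(B_{n-1}); the first row contributes
-- 0 + 1 + ⋯ + (n − 1) and the first column 2 + (n − 2) = n, together Σ_{i=1}^{n} i.
module Submission where

open import Defs
open import Data.Nat using (ℕ; _≤_; _+_; _∸_)
open import Relation.Binary.PropositionalEquality using (_≡_)

open import Data.Bool using (T; true; false)
open import Data.Bool.Properties using (T-∧; T-∨)
open import Data.Empty using (⊥-elim)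
open import Data.Fin using (Fin; toℕ; fromℕ<; inject₁)
import Data.Fin as F
open import Data.Fin.Properties using (toℕ<n; toℕ-fromℕ<; toℕ-inject₁; toℕ-injective)
open import Data.List using (List; []; _∷_; map; filter; allFin; tabulate; applyUpTo)
open import Data.List.Properties using (map-tabulate; map-cong; map-upTo)
open import Data.List.Membership.Propositional using (lose)
open import Data.List.Membership.Propositional.Properties using (∈-allFin)
open import Data.List.Relation.Unary.Any using (satisfied)
open import Data.List.Relation.Unary.Any.Properties using (any⁺; any⁻)
open import Data.Nat using (zero; suc; _<_; z≤n; s≤s; _≟_; _≤?_)
open import Data.Nat.ListAction using (sum)
open import Data.Nat.Properties
open import Data.Nat.Tactic.RingSolver using (solve-∀)
open import Algebra.Properties.CommutativeSemigroup +-commutativeSemigroup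
  using () renaming (interchange to +-interchange)
open import Data.Product using (∃-syntax; _×_; _,_)
open import Data.Sum using (_⊎_; inj₁; inj₂)
import Data.Sum as Sum
open import Function using (_∘_; id; _⇔_; Equivalence)
open import Relation.Binary.PropositionalEquality
  using (_≢_; refl; sym; trans; cong; subst; module ≡-Reasoning)
open import Relation.Nullary using (¬_; yes; no)
open import Relation.Nullary.Decidable using (⌊_⌋; ¬?; toWitness; fromWitness)

private
  variable
    n k d : ℕ

sumBelow : ℕ → (ℕ → ℕ) → ℕ
sumBelow zero    f = 0
sumBelow (suc m) f = f 0 + sumBelow m (f ∘ suc)

sumBelow-+ : ∀ m (f g : ℕ → ℕ) →
             sumBelow m (λ a → f a + g a) ≡ sumBelow m f + sumBelow m g
sumBelow-+ zero    f g = refl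
sumBelow-+ (suc m) f g = begin
  f 0 + g 0 + sumBelow m (λ a → f (suc a) + g (suc a))
    ≡⟨ cong (f 0 + g 0 +_) (sumBelow-+ m (f ∘ suc) (g ∘ suc)) ⟩
  f 0 + g 0 + (sumBelow m (f ∘ suc) + sumBelow m (g ∘ suc))
    ≡⟨ +-interchange (f 0) (g 0) _ _ ⟩
  f 0 + sumBelow m (f ∘ suc) + (g 0 + sumBelow m (g ∘ suc))  ∎
  where open ≡-Reasoning

sumBelow-one : ∀ m → sumBelow m (λ _ → 1) ≡ m
sumBelow-one zero    = refl
sumBelow-one (suc m) = cong suc (sumBelow-one m)

sum-applyUpTo : ∀ m (f : ℕ → ℕ) → sum (applyUpTo f m) ≡ sumBelow m f
sum-applyUpTo zero    f = refl
sum-applyUpTo (suc m) f = cong (f 0 +_) (sum-applyUpTo m (f ∘ suc))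

sumTo-sumBelow : ∀ m → sumTo m ≡ sumBelow m suc
sumTo-sumBelow m = trans (cong sum (map-upTo suc m)) (sum-applyUpTo m suc)

sum-tabulate-toℕ : ∀ m (f : ℕ → ℕ) → sum (tabulate (f ∘ toℕ {m})) ≡ sumBelow m f
sum-tabulate-toℕ zero    f = refl
sum-tabulate-toℕ (suc m) f = cong (f 0 +_) (sum-tabulate-toℕ m (f ∘ suc))

sum-map-allFin : ∀ m (f : ℕ → ℕ) → sum (map (f ∘ toℕ) (allFin m)) ≡ sumBelow m f
sum-map-allFin m f = trans (cong sum (map-tabulate {n = m} id (f ∘ toℕ))) (sum-tabulate-toℕ m f)

sum-map-filter-≢ : (f : Fin n → ℕ) (x : Fin n) → f x ≡ 0 → (ys : List (Fin n)) →
                   sum (map f (filter (λ y → ¬? (x F.≟ y)) ys)) ≡ sum (map f ys)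
sum-map-filter-≢ f x fx≡0 []       = refl
sum-map-filter-≢ f x fx≡0 (y ∷ ys) with x F.≟ y
... | yes refl = trans (sum-map-filter-≢ f x fx≡0 ys) (cong (_+ sum (map f ys)) (sym fx≡0))
... | no  _    = cong (f y +_) (sum-map-filter-≢ f x fx≡0 ys)

module _ {n : ℕ} (G : Digraph n) where

  walkIn-zero⁻ : ∀ {x y} → T (walkIn G 0 x y) → x ≡ y
  walkIn-zero⁻ = toWitness

  walkIn-zero⁺ : ∀ {x} → T (walkIn G 0 x x)
  walkIn-zero⁺ = fromWitness refl

  walkIn-suc⁺ : ∀ {x z y} → T (G x z) → T (walkIn G k z y) → T (walkIn G (suc k) x y)
  walkIn-suc⁺ {z = z} xz zy =
    any⁺ _ (lose (∈-allFin z) (Equivalence.from T-∧ (xz , zy)))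

  walkIn-suc⁻ : ∀ {x y} → T (walkIn G (suc k) x y) →
                ∃[ z ] T (G x z) × T (walkIn G k z y)
  walkIn-suc⁻ w with satisfied (any⁻ _ (allFin n) w)
  ... | z , xzy = z , Equivalence.to T-∧ xzy

  walkIn-one⁺ : ∀ {x y} → T (G x y) → T (walkIn G 1 x y)
  walkIn-one⁺ xy = walkIn-suc⁺ {k = 0} xy walkIn-zero⁺

  walkIn-one⁻ : ∀ {x y} → T (walkIn G 1 x y) → T (G x y)
  walkIn-one⁻ w with walkIn-suc⁻ {k = 0} w
  ... | z , xz , zy = subst (T ∘ G _) (walkIn-zero⁻ zy) xz

  firstWalk-≡ : ∀ {x y} fuel k₀ → k₀ ≤ d → d < k₀ + fuel →
                (∀ {k} → k < d → ¬ T (walkIn G k x y)) → T (walkIn G d x y) →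
                firstWalk G fuel k₀ x y ≡ d
  firstWalk-≡ zero k₀ k₀≤d d<k₀+0 _ _ =
    ⊥-elim (<⇒≱ (subst (_ <_) (+-identityʳ k₀) d<k₀+0) k₀≤d)
  firstWalk-≡ {x = x} {y} (suc fuel) k₀ k₀≤d d<k₀+1+fuel shorter w with walkIn G k₀ x y in eq
  ... | true with m≤n⇒m<n∨m≡n k₀≤d
  ...   | inj₁ k₀<d = ⊥-elim (shorter k₀<d (subst T (sym eq) _))
  ...   | inj₂ k₀≡d = k₀≡d
  firstWalk-≡ {d} {x} {y} (suc fuel) k₀ k₀≤d d<k₀+1+fuel shorter w | false =
    firstWalk-≡ fuel (suc k₀) (≤∧≢⇒< k₀≤d k₀≢d)
      (subst (d <_) (+-suc k₀ fuel) d<k₀+1+fuel) shorter w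
    where
      k₀≢d : k₀ ≢ d
      k₀≢d refl = subst T eq w

  dist-≡ : ∀ {x y} → d < n → (∀ {k} → k < d → ¬ T (walkIn G k x y)) →
           T (walkIn G d x y) → dist G x y ≡ d
  dist-≡ d<n = firstWalk-≡ n 0 z≤n d<n

module _ {n : ℕ} {a b : Fin n} where

  private
    T-backward : T (backward n a b) ⇔ (T ⌊ toℕ b ≟ suc (toℕ a) ⌋ ⊎ T ⌊ 2 + toℕ b ≤? toℕ a ⌋)
    T-backward = T-∨

  backward-step : toℕ b ≡ suc (toℕ a) → T (backward n a b)
  backward-step b≡1+a = Equivalence.from T-backward (inj₁ (fromWitness b≡1+a))

  backward-jump : 2 + toℕ b ≤ toℕ a → T (backward n a b)
  backward-jump 2+b≤a = Equivalence.from T-backward (inj₂ (fromWitness 2+b≤a))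

  backward-arrow⁻ : T (backward n a b) → toℕ b ≡ suc (toℕ a) ⊎ 2 + toℕ b ≤ toℕ a
  backward-arrow⁻ = Sum.map toWitness toWitness ∘ Equivalence.to T-backward

  backward-arrow-≤ : T (backward n a b) → toℕ b ≤ suc (toℕ a)
  backward-arrow-≤ ab with backward-arrow⁻ ab
  ... | inj₁ b≡1+a  = ≤-reflexive b≡1+a
  ... | inj₂ 2+b≤a = ≤-trans (m≤n+m (toℕ b) 2) (≤-trans 2+b≤a (n≤1+n _))

  backward-no-arrow-down-one : toℕ a ≡ suc (toℕ b) → ¬ T (backward n a b)
  backward-no-arrow-down-one a≡1+b ab with backward-arrow⁻ ab
  ... | inj₁ b≡1+a  = <-asym (≤-reflexive (sym a≡1+b)) (≤-reflexive (sym b≡1+a))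
  ... | inj₂ 2+b≤a = <⇒≢ 2+b≤a (sym a≡1+b)

backward-walk-≤ : ∀ {x y : Fin n} k → T (walkIn (backward n) k x y) → toℕ y ≤ toℕ x + k
backward-walk-≤ zero w rewrite walkIn-zero⁻ (backward _) w = m≤m+n _ 0
backward-walk-≤ {x = x} (suc k) w with walkIn-suc⁻ (backward _) {k = k} w
... | z , xz , zy = begin
  _                    ≤⟨ backward-walk-≤ k zy ⟩
  toℕ z + k            ≤⟨ +-monoˡ-≤ k (backward-arrow-≤ xz) ⟩
  suc (toℕ x) + k      ≡⟨ +-suc (toℕ x) k ⟨
  toℕ x + suc k        ∎
  where open ≤-Reasoning

backward-walk-up : ∀ {x y : Fin n} d → toℕ y ≡ toℕ x + d → T (walkIn (backward n) d x y)
backward-walk-up {x = x} zero y≡x+0 with toℕ-injective (trans y≡x+0 (+-identityʳ (toℕ x)))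
... | refl = walkIn-zero⁺ (backward _)
backward-walk-up {n} {x} {y} (suc d) y≡x+1+d =
  walkIn-suc⁺ (backward n) {k = d} (backward-step (toℕ-fromℕ< 1+x<n))
    (backward-walk-up d (trans y≡x+1+d (trans (+-suc (toℕ x) d)
                                              (cong (_+ d) (sym (toℕ-fromℕ< 1+x<n))))))
  where
    1+x<n : suc (toℕ x) < n
    1+x<n = begin-strict
      suc (toℕ x)       ≤⟨ m≤m+n _ d ⟩
      suc (toℕ x) + d   ≡⟨ +-suc (toℕ x) d ⟨
      toℕ x + suc d     ≡⟨ y≡x+1+d ⟨
      toℕ y             <⟨ toℕ<n y ⟩
      n                 ∎
      where open ≤-Reasoning

backward-walk-down-one : ∀ {x y : Fin n} → 3 ≤ n → toℕ x ≡ suc (toℕ y) →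
                         T (walkIn (backward n) 2 x y)
backward-walk-down-one {n} {x} {F.zero} 3≤n x≡1 =
  walkIn-suc⁺ (backward n) {k = 1} {z = fromℕ< 3≤n}
    (backward-step (trans (toℕ-fromℕ< 3≤n) (cong suc (sym x≡1))))
    (walkIn-one⁺ (backward n) (backward-jump (≤-reflexive (sym (toℕ-fromℕ< 3≤n)))))
backward-walk-down-one {n} {x} {F.suc c} _ x≡2+c =
  walkIn-suc⁺ (backward n) {k = 1} {z = inject₁ c}
    (backward-jump (≤-reflexive (trans (cong (2 +_) (toℕ-inject₁ c)) (sym x≡2+c))))
    (walkIn-one⁺ (backward n) (backward-step (cong suc (sym (toℕ-inject₁ c)))))

dist-backward-≤ : ∀ {x y : Fin n} → toℕ x ≤ toℕ y → dist (backward n) x y ≡ toℕ y ∸ toℕ x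
dist-backward-≤ {n} {x} {y} x≤y =
  dist-≡ (backward n) (≤-<-trans (m∸n≤m (toℕ y) (toℕ x)) (toℕ<n y)) too-short
    (backward-walk-up {x = x} (toℕ y ∸ toℕ x) (sym (m+[n∸m]≡n x≤y)))
  where
    too-short : ∀ {k} → k < toℕ y ∸ toℕ x → ¬ T (walkIn (backward n) k x y)
    too-short {k} k<y-x w = <-irrefl refl (begin-strict
      toℕ y                  ≤⟨ backward-walk-≤ k w ⟩
      toℕ x + k              <⟨ +-monoʳ-< (toℕ x) k<y-x ⟩
      toℕ x + (toℕ y ∸ toℕ x) ≡⟨ m+[n∸m]≡n x≤y ⟩
      toℕ y                  ∎)
      where open ≤-Reasoning

dist-backward-down-one : ∀ {x y : Fin n} → 3 ≤ n → toℕ x ≡ suc (toℕ y) →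
                         dist (backward n) x y ≡ 2
dist-backward-down-one {n} {x} {y} 3≤n x≡1+y =
  dist-≡ (backward n) 3≤n too-short (backward-walk-down-one 3≤n x≡1+y)
  where
    too-short : ∀ {k} → k < 2 → ¬ T (walkIn (backward n) k x y)
    too-short {zero}     _ w = 1+n≢n (trans (sym x≡1+y) (cong toℕ (walkIn-zero⁻ (backward n) w)))
    too-short {suc zero} _ w = backward-no-arrow-down-one x≡1+y (walkIn-one⁻ (backward n) w)
    too-short {suc (suc _)} (s≤s (s≤s ()))

dist-backward-jump : ∀ {x y : Fin n} → 2 + toℕ y ≤ toℕ x → dist (backward n) x y ≡ 1
dist-backward-jump {n} {x} {y} 2+y≤x =
  dist-≡ (backward n) (≤-<-trans (≤-trans (s≤s z≤n) 2+y≤x) (toℕ<n x)) too-short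
    (walkIn-one⁺ (backward n) (backward-jump 2+y≤x))
  where
    too-short : ∀ {k} → k < 1 → ¬ T (walkIn (backward n) k x y)
    too-short {zero} _ w =
      <-irrefl (sym (cong toℕ (walkIn-zero⁻ (backward n) w))) (≤-trans (n≤1+n _) 2+y≤x)
    too-short {suc _} (s≤s ())

backwardDist : ℕ → ℕ → ℕ
backwardDist zero          b       = b
backwardDist (suc a)       (suc b) = backwardDist a b
backwardDist (suc zero)    zero    = 2
backwardDist (suc (suc a)) zero    = 1

backwardDist-≤ : ∀ {a b} → a ≤ b → backwardDist a b ≡ b ∸ a
backwardDist-≤ {zero}  _         = refl
backwardDist-≤ {suc a} (s≤s a≤b) = backwardDist-≤ a≤b

backwardDist-refl : ∀ a → backwardDist a a ≡ 0
backwardDist-refl zero    = refl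
backwardDist-refl (suc a) = backwardDist-refl a

backwardDist-down-one : ∀ b → backwardDist (suc b) b ≡ 2
backwardDist-down-one zero    = refl
backwardDist-down-one (suc b) = backwardDist-down-one b

backwardDist-jump : ∀ {a b} → 2 + b ≤ a → backwardDist a b ≡ 1
backwardDist-jump {suc (suc a)} {zero}  _         = refl
backwardDist-jump {suc a}       {suc b} (s≤s 2+b≤a) = backwardDist-jump 2+b≤a

dist-backward : ∀ {x y : Fin n} → 3 ≤ n →
                dist (backward n) x y ≡ backwardDist (toℕ x) (toℕ y)
dist-backward {x = x} {y} 3≤n with toℕ x ≤? toℕ y
... | yes x≤y = trans (dist-backward-≤ x≤y) (sym (backwardDist-≤ x≤y))
... | no  x≰y with m≤n⇒m<n∨m≡n (≰⇒> x≰y)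
...   | inj₁ 2+y≤x = trans (dist-backward-jump 2+y≤x) (sym (backwardDist-jump 2+y≤x))
...   | inj₂ 1+y≡x = trans (dist-backward-down-one 3≤n (sym 1+y≡x))
                           (sym (subst (λ a → backwardDist a (toℕ y) ≡ 2) 1+y≡x
                                       (backwardDist-down-one (toℕ y))))

backwardσ : ℕ → ℕ
backwardσ m = sumBelow m (λ a → sumBelow m (backwardDist a))

σ-backward : 3 ≤ n → σ (backward n) ≡ backwardσ n
σ-backward {n} 3≤n =
  trans (cong sum (map-cong row (allFin n))) (sum-map-allFin n (sumBelow n ∘ backwardDist))
  where
    row : ∀ x → sum (map (dist (backward n) x) (filter (λ y → ¬? (x F.≟ y)) (allFin n)))
              ≡ sumBelow n (backwardDist (toℕ x))
    row x = begin
      sum (map (dist (backward n) x) (filter (λ y → ¬? (x F.≟ y)) (allFin n)))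
        ≡⟨ sum-map-filter-≢ (dist (backward n) x) x
             (trans (dist-backward 3≤n) (backwardDist-refl (toℕ x))) (allFin n) ⟩
      sum (map (dist (backward n) x) (allFin n))
        ≡⟨ cong sum (map-cong (λ y → dist-backward 3≤n) (allFin n)) ⟩
      sum (map (backwardDist (toℕ x) ∘ toℕ) (allFin n))
        ≡⟨ sum-map-allFin n (backwardDist (toℕ x)) ⟩
      sumBelow n (backwardDist (toℕ x))  ∎
      where open ≡-Reasoning

backwardσ-suc : ∀ k → backwardσ (suc (suc k)) ≡ backwardσ (suc k) + sumTo (suc (suc k))
backwardσ-suc k = begin
  backwardσ (suc m)
    ≡⟨⟩ -- unfolding splits off the first row, where backwardDist 0 b = b, and the first column
  sumBelow m suc + sumBelow m (λ a → backwardDist (suc a) 0 + sumBelow m (backwardDist a))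
    ≡⟨ cong (sumBelow m suc +_)
            (sumBelow-+ m (λ a → backwardDist (suc a) 0) (sumBelow m ∘ backwardDist)) ⟩
  sumBelow m suc + (2 + sumBelow k (λ _ → 1) + backwardσ m)
    ≡⟨ cong (λ c → sumBelow m suc + (2 + c + backwardσ m)) (sumBelow-one k) ⟩
  sumBelow m suc + (2 + k + backwardσ m)
    ≡⟨ rearrange (sumBelow m suc) k (backwardσ m) ⟩
  backwardσ m + (1 + (m + sumBelow m suc))
    ≡⟨ cong (λ c → backwardσ m + (1 + (c + sumBelow m suc))) (sumBelow-one m) ⟨
  backwardσ m + (1 + (sumBelow m (λ _ → 1) + sumBelow m suc))
    ≡⟨ cong (λ c → backwardσ m + (1 + c)) (sumBelow-+ m (λ _ → 1) suc) ⟨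
  backwardσ m + sumBelow (suc m) suc
    ≡⟨ cong (backwardσ m +_) (sumTo-sumBelow (suc m)) ⟨
  backwardσ m + sumTo (suc m)  ∎
  where
    open ≡-Reasoning
    m : ℕ
    m = suc k
    rearrange : ∀ s j t → s + (2 + j + t) ≡ t + (1 + (suc j + s))
    rearrange = solve-∀

lemma2 : ∀ (n : ℕ) → 4 ≤ n →
    σ (backward n) ≡ σ (backward (n ∸ 1)) + sumTo n
lemma2 (suc (suc k)) (s≤s 3≤1+k) = begin
  σ (backward (suc (suc k)))                 ≡⟨ σ-backward (≤-trans 3≤1+k (n≤1+n _)) ⟩
  backwardσ (suc (suc k))                    ≡⟨ backwardσ-suc k ⟩
  backwardσ (suc k) + sumTo (suc (suc k))    ≡⟨ cong (_+ sumTo (suc (suc k))) (σ-backward 3≤1+k) ⟨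
  σ (backward (suc k)) + sumTo (suc (suc k))  ∎
  where open ≡-Reasoning
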